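{- For every integer $i\geq 2$ and every graph $T$, $$t(C_2,T)^{2i-2}\,t(C_{2i+1},T)\geq t(C_3,T)^{2i-1}.$$
   Context: All graphs are finite and simple. $C_m$ denotes the cycle on $m$ vertices for $m\geq3$, and $C_2=K_2$ is the single edge. $\operatorname{hom}(H,T)$ is the number of maps $V(H)\to V(T)$ sending every edge of $H$ to an edge of $T$, and $t(H,T)=\operatorname{hom}(H,T)/v(T)^{v(H)}$. -}

module Defs where

open import Data.Bool using (Bool; true; false; not; _∨_; _∧_; T)
open import Data.Nat using (ℕ; zero; suc; _+_; _%_; _≡ᵇ_; _^_; NonZero)
open import Data.Nat.Properties using (m^n≢0)
open import Data.Fin using (Fin; toℕ)
open import Data.List using (List; []; _∷_; map; concatMap; length; filterᵇ; allFin)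
open import Data.Bool.ListAction using (and)
open import Data.Vec.Functional as VF using ()
open import Data.Integer using (+_)
open import Data.Rational using (ℚ; 1ℚ; _*_; _/_)
open import Relation.Binary.PropositionalEquality using (_≡_)

record Graph : Set where
  field
    n      : ℕ
    adj    : Fin n → Fin n → Bool
    sym    : ∀ u v → adj u v ≡ adj v u
    irrefl : ∀ v → adj v v ≡ false
open Graph public

v : Graph → ℕ
v = Graph.n

allMaps : (k m : ℕ) → List (Fin k → Fin m)
allMaps zero    m = (λ ()) ∷ []
allMaps (suc k) m = concatMap (λ f → map (λ x → x VF.∷ f) (allFin m)) (allMaps k m)

isHom : (k : ℕ) → (Fin k → Fin k → Bool) → (G : Graph) → (Fin k → Fin (v G)) → Bool
isHom k adjH G f =
  and (concatMap (λ a → map (λ b → not (adjH a b) ∨ adj G (f a) (f b)) (allFin k)) (allFin k))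

homP : (k : ℕ) → (Fin k → Fin k → Bool) → Graph → ℕ
homP k adjH G = length (filterᵇ (isHom k adjH G) (allMaps k (v G)))

hom : Graph → Graph → ℕ
hom H G = homP (v H) (adj H) G

-- The cycle C_m for m ≥ 2 (C_2 = K_2): vertices Fin m, a ~ b iff b ≡ a+1 (mod m) or a ≡ b+1 (mod m).
cycleAdj : (m : ℕ) → Fin m → Fin m → Bool
cycleAdj zero    a b = false
cycleAdj (suc p) a b = (toℕ b ≡ᵇ ((toℕ a + 1) % suc p)) ∨ (toℕ a ≡ᵇ ((toℕ b + 1) % suc p))

homC : ℕ → Graph → ℕ
homC m G = homP m (cycleAdj m) G

tC : (m : ℕ) (G : Graph) → .{{_ : NonZero (v G)}} → ℚ
tC m G = _/_ (+ homC m G) (v G ^ m) {{m^n≢0 (v G) m}}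

_^ℚ_ : ℚ → ℕ → ℚ
q ^ℚ zero  = 1ℚ
q ^ℚ suc k = q * (q ^ℚ k)

{-# OPTIONS --safe #-}
-- Write e = hom(C₂,T) = 2|E(T)| and t = hom(C₃,T). For a vertex x let L_x be its link graph, in which
-- y ~ z iff xyz is a triangle. Every closed walk x w₀ … w_{k+1} x with w a walk in L_x is a homomorphic
-- image of C_{k+3}, so hom(C_{k+3},T) ≥ Σₓ walks_{k+1}(L_x). Weight each walk of a graph L by the product
-- of the inverse degrees of its inner vertices: as the degree measure is stationary for the random walk,
-- these weights sum to 2e(L), and AM–GM along each walk gives the Blakley–Roy inequality in tangent-line
-- form: for every μ ≥ 0,
--   (k+1) μᵏ 2e(L) ≤ walks_{k+1}(L) + k μᵏ⁺¹ #{non-isolated vertices of L}.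
-- Summing over x, with Σₓ 2e(L_x) = t and Σₓ #{non-isolated vertices of L_x} ≤ e, and taking μ = t/e
-- gives t^{k+1} ≤ e^k hom(C_{k+3},T). Dividing by v(T)^{3(k+1)} gives the density form; k = 2i − 2.
module Submission where

open import Algebra.Bundles using (CommutativeRing)
open import Data.Bool using (Bool; true; false; not; _∧_; _∨_; T)
open import Data.Bool.ListAction using (and)
open import Data.Bool.Properties using (∧-conicalˡ; ∧-conicalʳ)
open import Data.Empty using (⊥-elim)
open import Data.Fin as Fin using (Fin; zero; suc; toℕ; inject₁)
import Data.Fin.Properties as Fin
import Data.Integer as ℤ
import Data.Integer.Properties as ℤ
open import Data.List using (List; []; _∷_; _++_; foldr; length; map; concatMap; filterᵇ; allFin)
open import Data.List.Membership.Propositional using (_∈_)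
open import Data.List.Membership.Propositional.Properties using (∈-allFin)
import Data.List.Properties as List
open import Data.List.Relation.Unary.All as All using (All; []; _∷_)
import Data.List.Relation.Unary.All.Properties as All
open import Data.List.Relation.Unary.Any using (here; there)
open import Data.Nat as ℕ using (ℕ; zero; suc)
open import Data.Nat.DivMod using (n%n≡0; m<n⇒m%n≡m)
import Data.Nat.Properties as ℕ
import Data.Nat.Solver as ℕ-Solver
open import Data.Product using (Σ; _×_; _,_; proj₁; proj₂)
open import Data.Rational using (ℚ; 0ℚ; 1ℚ; _/_; 1/_; toℚᵘ; positive; nonNegative; nonPositive; ≢-nonZero)
open import Data.Rational.Properties
open import Data.Rational.Solver using (module +-*-Solver)
import Data.Rational.Unnormalised as ℚᵘ
import Data.Rational.Unnormalised.Properties as ℚᵘ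
open import Data.Sum using (_⊎_; inj₁; inj₂)
open import Data.Unit using (tt)
import Data.Vec.Functional as Vec
open import Relation.Binary.PropositionalEquality
open import Relation.Nullary using (yes; no)

open import Algebra.Properties.CommutativeSemiring.Exp
  (CommutativeRing.commutativeSemiring +-*-commutativeRing)

open import Defs using (Graph; v; adj; isHom; allMaps; cycleAdj; homC; tC; _^ℚ_)

module Arithmetic where
  open import Data.Rational using (_+_; _*_; -_; _≤_; _<_)

  private variable
    p q r : ℚ

  fromℕ : ℕ → ℚ
  fromℕ k = ℤ.+ k / 1

  -- ℚ's _/_ normalises by a gcd that does not reduce on variables, so these identities are proved in ℚᵘ.
  fromℕ-suc : ∀ k → fromℕ (suc k) ≡ 1ℚ + fromℕ k
  fromℕ-suc k = toℚᵘ-injective (begin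
    toℚᵘ (fromℕ (suc k))
      ≈⟨ toℚᵘ-fromℚᵘ (ℚᵘ.mkℚᵘ (ℤ.+ suc k) 0) ⟩
    ℚᵘ.mkℚᵘ (ℤ.+ suc k) 0
      ≈⟨ ℚᵘ.*≡* (trans (ℤ.*-identityʳ _) (sym (trans (ℤ.*-identityʳ _) (cong (ℤ._+_ ℤ.1ℤ) (ℤ.*-identityʳ (ℤ.+ k)))))) ⟩
    ℚᵘ.1ℚᵘ ℚᵘ.+ ℚᵘ.mkℚᵘ (ℤ.+ k) 0
      ≈⟨ ℚᵘ.+-congʳ ℚᵘ.1ℚᵘ (toℚᵘ-fromℚᵘ (ℚᵘ.mkℚᵘ (ℤ.+ k) 0)) ⟨
    ℚᵘ.1ℚᵘ ℚᵘ.+ toℚᵘ (fromℕ k)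
      ≈⟨ toℚᵘ-homo-+ 1ℚ (fromℕ k) ⟨
    toℚᵘ (1ℚ + fromℕ k) ∎)
    where open ℚᵘ.≃-Reasoning

  fromℕ-+ : ∀ m n → fromℕ (m ℕ.+ n) ≡ fromℕ m + fromℕ n
  fromℕ-+ zero    n = sym (+-identityˡ (fromℕ n))
  fromℕ-+ (suc m) n = begin
    fromℕ (suc (m ℕ.+ n))     ≡⟨ fromℕ-suc (m ℕ.+ n) ⟩
    1ℚ + fromℕ (m ℕ.+ n)      ≡⟨ cong (λ x → 1ℚ + x) (fromℕ-+ m n) ⟩
    1ℚ + (fromℕ m + fromℕ n)  ≡⟨ +-assoc 1ℚ (fromℕ m) (fromℕ n) ⟨
    1ℚ + fromℕ m + fromℕ n    ≡⟨ cong (_+ fromℕ n) (fromℕ-suc m) ⟨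
    fromℕ (suc m) + fromℕ n   ∎
    where open ≡-Reasoning

  fromℕ-* : ∀ m n → fromℕ (m ℕ.* n) ≡ fromℕ m * fromℕ n
  fromℕ-* zero    n = sym (*-zeroˡ (fromℕ n))
  fromℕ-* (suc m) n = begin
    fromℕ (n ℕ.+ m ℕ.* n)              ≡⟨ fromℕ-+ n (m ℕ.* n) ⟩
    fromℕ n + fromℕ (m ℕ.* n)          ≡⟨ cong (λ x → fromℕ n + x) (fromℕ-* m n) ⟩
    fromℕ n + fromℕ m * fromℕ n        ≡⟨ cong (_+ fromℕ m * fromℕ n) (*-identityˡ (fromℕ n)) ⟨
    1ℚ * fromℕ n + fromℕ m * fromℕ n   ≡⟨ *-distribʳ-+ (fromℕ n) 1ℚ (fromℕ m) ⟨
    (1ℚ + fromℕ m) * fromℕ n           ≡⟨ cong (_* fromℕ n) (fromℕ-suc m) ⟨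
    fromℕ (suc m) * fromℕ n            ∎
    where open ≡-Reasoning

  fromℕ-^ : ∀ m k → fromℕ (m ℕ.^ k) ≡ fromℕ m ^ k
  fromℕ-^ m zero    = refl
  fromℕ-^ m (suc k) = trans (fromℕ-* m (m ℕ.^ k)) (cong (fromℕ m *_) (fromℕ-^ m k))

  fromℕ-nonNeg : ∀ k → 0ℚ ≤ fromℕ k
  fromℕ-nonNeg k = nonNegative⁻¹ (fromℕ k) {{normalize-nonNeg k 1}}

  fromℕ-pos : ∀ k .{{_ : ℕ.NonZero k}} → 0ℚ < fromℕ k
  fromℕ-pos k = positive⁻¹ (fromℕ k) {{normalize-pos k 1}}

  /-*-fromℕ : ∀ m d .{{_ : ℕ.NonZero d}} → (ℤ.+ m / d) * fromℕ d ≡ fromℕ m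
  /-*-fromℕ m d@(suc d-1) = toℚᵘ-injective (begin
    toℚᵘ ((ℤ.+ m / d) * fromℕ d)
      ≈⟨ toℚᵘ-homo-* (ℤ.+ m / d) (fromℕ d) ⟩
    toℚᵘ (ℤ.+ m / d) ℚᵘ.* toℚᵘ (fromℕ d)
      ≈⟨ ℚᵘ.*-cong (toℚᵘ-fromℚᵘ (ℚᵘ.mkℚᵘ (ℤ.+ m) d-1)) (toℚᵘ-fromℚᵘ (ℚᵘ.mkℚᵘ (ℤ.+ d) 0)) ⟩
    ℚᵘ.mkℚᵘ (ℤ.+ m) d-1 ℚᵘ.* ℚᵘ.mkℚᵘ (ℤ.+ d) 0
      ≈⟨ ℚᵘ.*≡* (trans (cong (λ z → ℤ.+ m ℤ.* ℤ.+ suc z) (ℕ.*-identityʳ d-1)) (sym (ℤ.*-identityʳ (ℤ.+ m ℤ.* ℤ.+ d)))) ⟨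
    ℚᵘ.mkℚᵘ (ℤ.+ m) 0
      ≈⟨ toℚᵘ-fromℚᵘ (ℚᵘ.mkℚᵘ (ℤ.+ m) 0) ⟨
    toℚᵘ (fromℕ m) ∎)
    where open ℚᵘ.≃-Reasoning

  +-nonNeg : 0ℚ ≤ p → 0ℚ ≤ q → 0ℚ ≤ p + q
  +-nonNeg {p} {q} 0≤p 0≤q =
    nonNegative⁻¹ _ {{nonNeg+nonNeg⇒nonNeg p {{nonNegative 0≤p}} q {{nonNegative 0≤q}}}}

  *-nonNeg : 0ℚ ≤ p → 0ℚ ≤ q → 0ℚ ≤ p * q
  *-nonNeg {p} {q} 0≤p 0≤q =
    nonNegative⁻¹ _ {{nonNeg*nonNeg⇒nonNeg p {{nonNegative 0≤p}} q {{nonNegative 0≤q}}}}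

  *-pos : 0ℚ < p → 0ℚ < q → 0ℚ < p * q
  *-pos {p} {q} 0<p 0<q = positive⁻¹ _ {{pos*pos⇒pos p {{positive 0<p}} q {{positive 0<q}}}}

  *-monoˡ-≤-nonNeg′ : 0ℚ ≤ r → p ≤ q → r * p ≤ r * q
  *-monoˡ-≤-nonNeg′ {r} 0≤r = *-monoˡ-≤-nonNeg r {{nonNegative 0≤r}}

  *-monoʳ-≤-nonNeg′ : 0ℚ ≤ r → p ≤ q → p * r ≤ q * r
  *-monoʳ-≤-nonNeg′ {r} 0≤r = *-monoʳ-≤-nonNeg r {{nonNegative 0≤r}}

  *-cancelˡ-≤-pos′ : 0ℚ < r → r * p ≤ r * q → p ≤ q
  *-cancelˡ-≤-pos′ {r} 0<r = *-cancelˡ-≤-pos r {{positive 0<r}}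

  +-cancelʳ-≤ : ∀ p q r → p + r ≤ q + r → p ≤ q
  +-cancelʳ-≤ p q r p+r≤q+r = subst₂ _≤_ (cancel p) (cancel q) (+-monoˡ-≤ (- r) p+r≤q+r)
    where
    open +-*-Solver
    cancel : ∀ x → x + r + - r ≡ x
    cancel x = solve 2 (λ x r → x :+ r :+ :- r := x) refl x r

  p≤p+q : 0ℚ ≤ q → p ≤ p + q
  p≤p+q {q} {p} 0≤q = subst (_≤ p + q) (+-identityʳ p) (+-monoʳ-≤ p 0≤q)

  p≤q+p : 0ℚ ≤ q → p ≤ q + p
  p≤q+p {q} {p} 0≤q = subst (_≤ q + p) (+-identityˡ p) (+-monoˡ-≤ p 0≤q)

  square-nonNeg : ∀ p → 0ℚ ≤ p * p
  square-nonNeg p with ≤-total 0ℚ p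
  ... | inj₁ 0≤p = *-nonNeg 0≤p 0≤p
  ... | inj₂ p≤0 = nonNegative⁻¹ _ {{nonPos*nonPos⇒nonPos p {{nonPositive p≤0}} p {{nonPositive p≤0}}}}

  ^-nonNeg : ∀ k → 0ℚ ≤ p → 0ℚ ≤ p ^ k
  ^-nonNeg zero    _   = nonNegative⁻¹ 1ℚ
  ^-nonNeg (suc k) 0≤p = *-nonNeg 0≤p (^-nonNeg k 0≤p)

  ^-pos : ∀ k → 0ℚ < p → 0ℚ < p ^ k
  ^-pos zero    _   = positive⁻¹ 1ℚ
  ^-pos (suc k) 0<p = *-pos 0<p (^-pos k 0<p)

  ^-monoˡ-≤ : ∀ k → 0ℚ ≤ p → p ≤ q → p ^ k ≤ q ^ k
  ^-monoˡ-≤ zero    _   _   = ≤-refl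
  ^-monoˡ-≤ (suc k) 0≤p p≤q = ≤-trans (*-monoˡ-≤-nonNeg′ 0≤p (^-monoˡ-≤ k 0≤p p≤q))
                                      (*-monoʳ-≤-nonNeg′ (^-nonNeg k (≤-trans 0≤p p≤q)) p≤q)

  ^-monoˡ-< : ∀ k → 0ℚ ≤ p → p < q → p ^ suc k < q ^ suc k
  ^-monoˡ-< {q = q} k 0≤p p<q = ≤-<-trans (*-monoˡ-≤-nonNeg′ 0≤p (^-monoˡ-≤ k 0≤p (<⇒≤ p<q)))
    (*-monoˡ-<-pos (q ^ k) {{positive (^-pos k (≤-<-trans 0≤p p<q))}} p<q)

  ^-cancelˡ-≤ : ∀ k → 0ℚ ≤ q → p ^ suc k ≤ q ^ suc k → p ≤ q
  ^-cancelˡ-≤ {q = q} {p = p} k 0≤q pᵏ⁺¹≤qᵏ⁺¹ with p ≤? q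
  ... | yes p≤q = p≤q
  ... | no  p≰q = ⊥-elim (<-irrefl refl (≤-<-trans pᵏ⁺¹≤qᵏ⁺¹ (^-monoˡ-< k 0≤q (≰⇒> p≰q))))

  ^ℚ≗^ : ∀ p k → p ^ℚ k ≡ p ^ k
  ^ℚ≗^ p zero    = refl
  ^ℚ≗^ p (suc k) = cong (p *_) (^ℚ≗^ p k)

  -- A total inverse: inv 0ℚ = 0ℚ, so p * inv p is the indicator of p ≢ 0ℚ.
  inv : ℚ → ℚ
  inv p with p ≟ 0ℚ
  ... | yes _   = 0ℚ
  ... | no  p≢0 = (1/ p) {{≢-nonZero p≢0}}

  inv-nonNeg : 0ℚ ≤ p → 0ℚ ≤ inv p
  inv-nonNeg {p} 0≤p with p ≟ 0ℚ
  ... | yes _   = ≤-refl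
  ... | no  p≢0 = <⇒≤ (positive⁻¹ _ {{1/pos⇒pos p {{nonNeg∧nonZero⇒pos p {{nonNegative 0≤p}} {{≢-nonZero p≢0}}}}}})

  *-inv : p ≢ 0ℚ → p * inv p ≡ 1ℚ
  *-inv {p} p≢0 with p ≟ 0ℚ
  ... | yes p≡0  = ⊥-elim (p≢0 p≡0)
  ... | no  p≢0′ = *-inverseʳ p {{≢-nonZero p≢0′}}

  *-inv≤1 : ∀ p → p * inv p ≤ 1ℚ
  *-inv≤1 p with p ≟ 0ℚ
  ... | yes _   = ≤-trans (≤-reflexive (*-zeroʳ p)) (nonNegative⁻¹ 1ℚ)
  ... | no  p≢0 = ≤-reflexive (*-inverseʳ p {{≢-nonZero p≢0}})

  *-inv-*-inv : ∀ p → p * inv p * inv p ≡ inv p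
  *-inv-*-inv p with p ≟ 0ℚ
  ... | yes _   = *-zeroʳ (p * 0ℚ)
  ... | no  p≢0 = trans (cong (_* (1/ p) {{≢-nonZero p≢0}}) (*-inverseʳ p {{≢-nonZero p≢0}})) (*-identityˡ _)

module Sums where
  open import Data.Rational using (_+_; _*_; _≤_)
  open Arithmetic

  private variable
    A B : Set
    f g : A → ℚ

  sum : List ℚ → ℚ
  sum = foldr _+_ 0ℚ

  product : List ℚ → ℚ
  product = foldr _*_ 1ℚ

  infixr 5 ∑ ∑<

  ∑ : List A → (A → ℚ) → ℚ
  ∑ xs f = sum (map f xs)

  syntax ∑ xs (λ x → e) = ∑[ x ∈ xs ] e

  ∑< : (n : ℕ) → (Fin n → ℚ) → ℚ
  ∑< n f = ∑ (allFin n) f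

  syntax ∑< n (λ x → e) = ∑[ x < n ] e

  sum-nonNeg : ∀ {xs} → All (0ℚ ≤_) xs → 0ℚ ≤ sum xs
  sum-nonNeg []           = ≤-refl
  sum-nonNeg (0≤x ∷ 0≤xs) = +-nonNeg 0≤x (sum-nonNeg 0≤xs)

  product-nonNeg : ∀ {xs} → All (0ℚ ≤_) xs → 0ℚ ≤ product xs
  product-nonNeg []           = nonNegative⁻¹ 1ℚ
  product-nonNeg (0≤x ∷ 0≤xs) = *-nonNeg 0≤x (product-nonNeg 0≤xs)

  sum-map-*ˡ : ∀ c xs → sum (map (c *_) xs) ≡ c * sum xs
  sum-map-*ˡ c []       = sym (*-zeroʳ c)
  sum-map-*ˡ c (x ∷ xs) = trans (cong (λ s → c * x + s) (sum-map-*ˡ c xs)) (sym (*-distribˡ-+ c x (sum xs)))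

  product-map-*ˡ : ∀ c xs → product (map (c *_) xs) ≡ c ^ length xs * product xs
  product-map-*ˡ c []       = sym (*-identityˡ 1ℚ)
  product-map-*ˡ c (x ∷ xs) = trans (cong (c * x *_) (product-map-*ˡ c xs)) (rearrange c x (c ^ length xs) (product xs))
    where
    open +-*-Solver
    rearrange : ∀ c x y z → c * x * (y * z) ≡ c * y * (x * z)
    rearrange = solve 4 (λ c x y z → c :* x :* (y :* z) := c :* y :* (x :* z)) refl

  ∑-cong : ∀ (xs : List A) → (∀ x → f x ≡ g x) → ∑ xs f ≡ ∑ xs g
  ∑-cong []       f≗g = refl
  ∑-cong (x ∷ xs) f≗g = cong₂ _+_ (f≗g x) (∑-cong xs f≗g)

  ∑-mono-≤ : ∀ (xs : List A) → (∀ x → f x ≤ g x) → ∑ xs f ≤ ∑ xs g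
  ∑-mono-≤ []       f≤g = ≤-refl
  ∑-mono-≤ (x ∷ xs) f≤g = +-mono-≤ (f≤g x) (∑-mono-≤ xs f≤g)

  ∑-nonNeg : ∀ (xs : List A) → (∀ x → 0ℚ ≤ f x) → 0ℚ ≤ ∑ xs f
  ∑-nonNeg xs 0≤f = sum-nonNeg (All.map⁺ (All.universal 0≤f xs))

  ∑-zero : ∀ (xs : List A) → ∑[ x ∈ xs ] 0ℚ ≡ 0ℚ
  ∑-zero []       = refl
  ∑-zero (x ∷ xs) = trans (+-identityˡ _) (∑-zero xs)

  ∑-distrib-+ : ∀ (xs : List A) f g → ∑[ x ∈ xs ] (f x + g x) ≡ ∑ xs f + ∑ xs g
  ∑-distrib-+ []       f g = sym (+-identityˡ 0ℚ)
  ∑-distrib-+ (x ∷ xs) f g = trans (cong (λ s → f x + g x + s) (∑-distrib-+ xs f g))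
                                   (+-interchange (f x) (g x) (∑ xs f) (∑ xs g))
    where
    open +-*-Solver
    +-interchange : ∀ a b c d → a + b + (c + d) ≡ a + c + (b + d)
    +-interchange = solve 4 (λ a b c d → a :+ b :+ (c :+ d) := a :+ c :+ (b :+ d)) refl

  *-distribˡ-∑ : ∀ c (xs : List A) f → c * ∑ xs f ≡ ∑[ x ∈ xs ] c * f x
  *-distribˡ-∑ c xs f = trans (sym (sum-map-*ˡ c (map f xs))) (cong sum (sym (List.map-∘ xs)))

  *-distribʳ-∑ : ∀ c (xs : List A) f → ∑ xs f * c ≡ ∑[ x ∈ xs ] f x * c
  *-distribʳ-∑ c xs f = trans (*-comm (∑ xs f) c) (trans (*-distribˡ-∑ c xs f) (∑-cong xs (λ x → *-comm c (f x))))

  ∑-++ : ∀ (xs ys : List A) f → ∑ (xs ++ ys) f ≡ ∑ xs f + ∑ ys f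
  ∑-++ []       ys f = sym (+-identityˡ _)
  ∑-++ (x ∷ xs) ys f = trans (cong (f x +_) (∑-++ xs ys f)) (sym (+-assoc (f x) _ _))

  ∑-map : ∀ (h : A → B) xs f → ∑ (map h xs) f ≡ ∑[ x ∈ xs ] f (h x)
  ∑-map h xs f = cong sum (sym (List.map-∘ xs))

  ∑-concatMap : ∀ (F : A → List B) xs f → ∑ (concatMap F xs) f ≡ ∑[ x ∈ xs ] ∑ (F x) f
  ∑-concatMap F []       f = refl
  ∑-concatMap F (x ∷ xs) f = trans (∑-++ (F x) (concatMap F xs) f) (cong (∑ (F x) f +_) (∑-concatMap F xs f))

  ∑-comm : ∀ (xs : List A) (ys : List B) (f : A → B → ℚ) →
           ∑[ x ∈ xs ] ∑[ y ∈ ys ] f x y ≡ ∑[ y ∈ ys ] ∑[ x ∈ xs ] f x y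
  ∑-comm []       ys f = sym (∑-zero ys)
  ∑-comm (x ∷ xs) ys f = trans (cong ((∑[ y ∈ ys ] f x y) +_) (∑-comm xs ys f))
                               (sym (∑-distrib-+ ys (f x) (λ y → ∑[ x′ ∈ xs ] f x′ y)))

  ≤-∑ : ∀ (xs : List A) → (∀ x → 0ℚ ≤ f x) → ∀ {x} → x ∈ xs → f x ≤ ∑ xs f
  ≤-∑ (x ∷ xs) 0≤f (here refl)  = p≤p+q (∑-nonNeg xs 0≤f)
  ≤-∑ (x ∷ xs) 0≤f (there y∈xs) = ≤-trans (≤-∑ xs 0≤f y∈xs) (p≤q+p (0≤f x))

  𝟙 : Bool → ℚ
  𝟙 true  = 1ℚ
  𝟙 false = 0ℚ

  𝟙-nonNeg : ∀ b → 0ℚ ≤ 𝟙 b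
  𝟙-nonNeg true  = nonNegative⁻¹ 1ℚ
  𝟙-nonNeg false = ≤-refl

  𝟙-∧ : ∀ a b → 𝟙 (a ∧ b) ≡ 𝟙 a * 𝟙 b
  𝟙-∧ true  b = sym (*-identityˡ (𝟙 b))
  𝟙-∧ false b = sym (*-zeroˡ (𝟙 b))

  𝟙-mono : ∀ {a b} → (a ≡ true → b ≡ true) → 𝟙 a ≤ 𝟙 b
  𝟙-mono {false} {b}  _   = 𝟙-nonNeg b
  𝟙-mono {true}  a⇒b with refl ← a⇒b refl = ≤-refl

  𝟙≤⇒≢0 : ∀ {b s} → b ≡ true → 𝟙 b ≤ s → s ≢ 0ℚ
  𝟙≤⇒≢0 refl 1≤s refl = <-irrefl refl (<-≤-trans (positive⁻¹ 1ℚ) 1≤s)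

  length-filterᵇ : ∀ (P : A → Bool) xs → fromℕ (length (filterᵇ P xs)) ≡ ∑[ x ∈ xs ] 𝟙 (P x)
  length-filterᵇ P []       = refl
  length-filterᵇ P (x ∷ xs) with P x
  ... | true  = trans (fromℕ-suc (length (filterᵇ P xs))) (cong (1ℚ +_) (length-filterᵇ P xs))
  ... | false = trans (length-filterᵇ P xs) (sym (+-identityˡ _))

  ∑-allMaps-zero : ∀ n (H : (Fin 0 → Fin n) → ℚ) → ∑[ g ∈ allMaps 0 n ] H g ≡ H (λ ())
  ∑-allMaps-zero n H = +-identityʳ (H (λ ()))

  ∑-allMaps-suc : ∀ k n (H : (Fin (suc k) → Fin n) → ℚ) →
                  ∑[ g ∈ allMaps (suc k) n ] H g ≡ ∑[ g ∈ allMaps k n ] ∑[ x < n ] H (x Vec.∷ g)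
  ∑-allMaps-suc k n H = trans (∑-concatMap (λ g → map (Vec._∷ g) (allFin n)) (allMaps k n) H)
                              (∑-cong (allMaps k n) (λ g → ∑-map (Vec._∷ g) (allFin n) H))

module AM-GM where
  open import Data.Rational using (_+_; _*_; _-_; _≤_)
  open Arithmetic
  open Sums
  open +-*-Solver

  bernoulli : ∀ j p q → 0ℚ ≤ p → 0ℚ ≤ p + q →
              p ^ suc j + fromℕ (suc j) * p ^ j * q ≤ (p + q) ^ suc j
  bernoulli zero    p q _   _     =
    ≤-reflexive (solve 2 (λ p q → p :* con 1ℚ :+ con 1ℚ :* con 1ℚ :* q := (p :+ q) :* con 1ℚ) refl p q)
  bernoulli (suc j) p q 0≤p 0≤p+q = begin
    p ^ suc (suc j) + fromℕ (suc (suc j)) * p ^ suc j * q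
      ≡⟨ cong (λ c → p ^ suc (suc j) + c * p ^ suc j * q) (fromℕ-suc (suc j)) ⟩
    p * (p * pʲ) + (1ℚ + j⁺) * (p * pʲ) * q
      ≤⟨ p≤p+q (*-nonNeg (*-nonNeg (fromℕ-nonNeg (suc j)) (^-nonNeg j 0≤p)) (square-nonNeg q)) ⟩
    p * (p * pʲ) + (1ℚ + j⁺) * (p * pʲ) * q + j⁺ * pʲ * (q * q)
      ≡⟨ solve 4 (λ p q pʲ j⁺ → p :* (p :* pʲ) :+ (con 1ℚ :+ j⁺) :* (p :* pʲ) :* q :+ j⁺ :* pʲ :* (q :* q)
                              := (p :+ q) :* (p :* pʲ :+ j⁺ :* pʲ :* q)) refl p q pʲ j⁺ ⟩
    (p + q) * (p ^ suc j + j⁺ * pʲ * q)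
      ≤⟨ *-monoˡ-≤-nonNeg′ 0≤p+q (bernoulli j p q 0≤p 0≤p+q) ⟩
    (p + q) * (p + q) ^ suc j ∎
    where
    open ≤-Reasoning
    pʲ = p ^ j
    j⁺ = fromℕ (suc j)

  -- Bernoulli's inequality at p = (m+1)S, q = mx − S, divided by m.
  am-gm-step : ∀ m .{{_ : ℕ.NonZero m}} S x → 0ℚ ≤ S → 0ℚ ≤ x →
               fromℕ (suc m) ^ suc m * S ^ m * x ≤ fromℕ m ^ m * (S + x) ^ suc m
  am-gm-step m S x 0≤S 0≤x = *-cancelˡ-≤-pos′ (fromℕ-pos m) (begin
    M * (I ^ suc m * S ^ m * x)      ≡⟨ bernoulli-lhs ⟩
    p ^ suc m + I * p ^ m * q        ≤⟨ bernoulli m p q 0≤p 0≤p+q ⟩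
    (p + q) ^ suc m                  ≡⟨ cong (_^ suc m) p+q≡M[S+x] ⟩
    (M * (S + x)) ^ suc m            ≡⟨ ^-distrib-* M (S + x) (suc m) ⟩
    M ^ suc m * (S + x) ^ suc m      ≡⟨ *-assoc M (M ^ m) ((S + x) ^ suc m) ⟩
    M * (M ^ m * (S + x) ^ suc m)    ∎)
    where
    open ≤-Reasoning
    I = fromℕ (suc m)
    M = fromℕ m
    p = I * S
    q = M * x - S
    p+q≡M[S+x] : p + q ≡ M * (S + x)
    p+q≡M[S+x] = trans (cong (λ i → i * S + q) (fromℕ-suc m))
      (solve 3 (λ M S x → (con 1ℚ :+ M) :* S :+ (M :* x :- S) := M :* (S :+ x)) refl M S x)
    0≤p : 0ℚ ≤ p
    0≤p = *-nonNeg (fromℕ-nonNeg (suc m)) 0≤S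
    0≤p+q : 0ℚ ≤ p + q
    0≤p+q = subst (0ℚ ≤_) (sym p+q≡M[S+x]) (*-nonNeg (fromℕ-nonNeg m) (+-nonNeg 0≤S 0≤x))
    bernoulli-lhs : M * (I ^ suc m * S ^ m * x) ≡ p ^ suc m + I * p ^ m * q
    bernoulli-lhs = trans
      (solve 6 (λ I Iᵐ S Sᵐ M x → M :* (I :* Iᵐ :* Sᵐ :* x)
                                 := I :* Iᵐ :* (S :* Sᵐ) :+ I :* (Iᵐ :* Sᵐ) :* (M :* x :- S))
               refl I (I ^ m) S (S ^ m) M x)
      (sym (cong₂ (λ a b → a + I * b * q) (^-distrib-* I S (suc m)) (^-distrib-* I S m)))

  am-gm : ∀ xs → All (0ℚ ≤_) xs → fromℕ (length xs) ^ length xs * product xs ≤ sum xs ^ length xs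
  am-gm []       []      = ≤-reflexive (*-identityˡ 1ℚ)
  am-gm (x ∷ []) (_ ∷ []) =
    ≤-reflexive (solve 1 (λ x → con 1ℚ :* con 1ℚ :* (x :* con 1ℚ) := (x :+ con 0ℚ) :* con 1ℚ) refl x)
  am-gm (x ∷ ys@(_ ∷ _)) (0≤x ∷ 0≤ys) = *-cancelˡ-≤-pos′ (^-pos m (fromℕ-pos m)) (begin
    Mᵐ * (I ^ suc m * (x * P))   ≡⟨ solve 4 (λ Mᵐ Iᵐ⁺¹ x P → Mᵐ :* (Iᵐ⁺¹ :* (x :* P)) := Iᵐ⁺¹ :* x :* (Mᵐ :* P))
                                           refl Mᵐ (I ^ suc m) x P ⟩
    I ^ suc m * x * (Mᵐ * P)     ≤⟨ *-monoˡ-≤-nonNeg′ (*-nonNeg (^-nonNeg (suc m) (fromℕ-nonNeg (suc m))) 0≤x)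
                                                      (am-gm ys 0≤ys) ⟩
    I ^ suc m * x * S ^ m        ≡⟨ solve 3 (λ Iᵐ⁺¹ x Sᵐ → Iᵐ⁺¹ :* x :* Sᵐ := Iᵐ⁺¹ :* Sᵐ :* x) refl (I ^ suc m) x (S ^ m) ⟩
    I ^ suc m * S ^ m * x        ≤⟨ am-gm-step m S x (sum-nonNeg 0≤ys) 0≤x ⟩
    Mᵐ * (S + x) ^ suc m         ≡⟨ cong (λ s → Mᵐ * s ^ suc m) (+-comm S x) ⟩
    Mᵐ * (x + S) ^ suc m         ∎)
    where
    open ≤-Reasoning
    m  = length ys
    I  = fromℕ (suc m)
    Mᵐ = fromℕ m ^ m
    S  = sum ys
    P  = product ys

  -- AM–GM for the numbers 1, c x₁, …, c xₗ with c = μˡ⁺¹ ∏ x, whose product is (μˡ ∏ x)ˡ⁺¹.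
  am-gm-linearised : ∀ xs μ → All (0ℚ ≤_) xs → 0ℚ ≤ μ →
    fromℕ (suc (length xs)) * μ ^ length xs * product xs ≤ 1ℚ + μ ^ suc (length xs) * product xs * sum xs
  am-gm-linearised xs μ 0≤xs 0≤μ = subst₂ _≤_ (sym (*-assoc I (μ ^ l) P)) (cong (1ℚ +_) (sum-map-*ˡ c xs))
    (^-cancelˡ-≤ l (sum-nonNeg 0≤ys) (begin
      (I * (μ ^ l * P)) ^ suc l      ≡⟨ ^-distrib-* I (μ ^ l * P) (suc l) ⟩
      I ^ suc l * (μ ^ l * P) ^ suc l ≡⟨ cong (I ^ suc l *_) power-of-product ⟩
      I ^ suc l * product ys         ≤⟨ am-gm-on-ys ⟩
      sum ys ^ suc l                 ∎))
    where
    open ≤-Reasoning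
    l = length xs
    I = fromℕ (suc l)
    P = product xs
    c = μ ^ suc l * P
    ys = 1ℚ ∷ map (c *_) xs
    0≤ys : All (0ℚ ≤_) ys
    0≤ys = nonNegative⁻¹ 1ℚ ∷ All.map⁺ (All.map (*-nonNeg (*-nonNeg (^-nonNeg (suc l) 0≤μ) (product-nonNeg 0≤xs))) 0≤xs)
    am-gm-on-ys : I ^ suc l * product ys ≤ sum ys ^ suc l
    am-gm-on-ys = subst (λ k → fromℕ k ^ k * product ys ≤ sum ys ^ k)
                        (cong suc (List.length-map (c *_) xs)) (am-gm ys 0≤ys)
    power-of-product : (μ ^ l * P) ^ suc l ≡ product ys
    power-of-product = begin-equality
      (μ ^ l * P) ^ suc l                ≡⟨ ^-distrib-* (μ ^ l) P (suc l) ⟩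
      (μ ^ l) ^ suc l * (P * P ^ l)       ≡⟨ cong (_* (P * P ^ l)) exponents ⟩
      (μ ^ suc l) ^ l * (P * P ^ l)       ≡⟨ solve 3 (λ X P Pˡ → X :* (P :* Pˡ) := con 1ℚ :* (X :* Pˡ :* P)) refl
                                                     ((μ ^ suc l) ^ l) P (P ^ l) ⟩
      1ℚ * ((μ ^ suc l) ^ l * P ^ l * P)  ≡⟨ cong (λ z → 1ℚ * (z * P)) (^-distrib-* (μ ^ suc l) P l) ⟨
      1ℚ * (c ^ l * P)                   ≡⟨ cong (1ℚ *_) (product-map-*ˡ c xs) ⟨
      product ys                         ∎
      where
      exponents : (μ ^ l) ^ suc l ≡ (μ ^ suc l) ^ l
      exponents = trans (^-assocʳ μ l (suc l)) (trans (cong (μ ^_) (ℕ.*-comm l (suc l))) (sym (^-assocʳ μ (suc l) l)))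

  tangent-at-slope : ∀ k {a d N} μ → 0ℚ ≤ d → μ * d ≡ a →
    fromℕ (suc k) * μ ^ k * a ≤ N + μ ^ suc k * (fromℕ k * d) → a ^ suc k ≤ N * d ^ k
  tangent-at-slope k {a} {d} {N} μ 0≤d μd≡a tangent = begin
    a ^ suc k         ≡⟨ *-comm a (a ^ k) ⟩
    a ^ k * a         ≡⟨ cong (λ x → x ^ k * a) (trans (*-comm d μ) μd≡a) ⟨
    (d * μ) ^ k * a   ≡⟨ cong (_* a) (^-distrib-* d μ k) ⟩
    d ^ k * μ ^ k * a ≡⟨ *-assoc (d ^ k) (μ ^ k) a ⟩
    d ^ k * X         ≤⟨ *-monoˡ-≤-nonNeg′ (^-nonNeg k 0≤d) X≤N ⟩
    d ^ k * N         ≡⟨ *-comm (d ^ k) N ⟩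
    N * d ^ k         ∎
    where
    open ≤-Reasoning
    X = μ ^ k * a
    X+kX≤N+kX : X + fromℕ k * X ≤ N + fromℕ k * X
    X+kX≤N+kX = subst₂ _≤_
      (trans (cong (λ c → c * μ ^ k * a) (fromℕ-suc k))
             (solve 3 (λ K μᵏ a → (con 1ℚ :+ K) :* μᵏ :* a := μᵏ :* a :+ K :* (μᵏ :* a)) refl (fromℕ k) (μ ^ k) a))
      (cong (N +_) (trans (solve 4 (λ μ μᵏ K d → μ :* μᵏ :* (K :* d) := K :* (μᵏ :* (μ :* d))) refl μ (μ ^ k) (fromℕ k) d)
                          (cong (λ y → fromℕ k * (μ ^ k * y)) μd≡a)))
      tangent
    X≤N : X ≤ N
    X≤N = +-cancelʳ-≤ X N (fromℕ k * X) X+kX≤N+kX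

  tangent-line-bound : ∀ k {a d N} → 0ℚ ≤ a → 0ℚ ≤ d → 0ℚ ≤ N → (d ≡ 0ℚ → a ≡ 0ℚ) →
    (∀ μ → 0ℚ ≤ μ → fromℕ (suc k) * μ ^ k * a ≤ N + μ ^ suc k * (fromℕ k * d)) →
    a ^ suc k ≤ N * d ^ k
  tangent-line-bound k {a} {d} {N} 0≤a 0≤d 0≤N d≡0⇒a≡0 tangent with d ≟ 0ℚ
  ... | yes d≡0 = begin
    a ^ suc k         ≡⟨ cong (λ x → x * a ^ k) (d≡0⇒a≡0 d≡0) ⟩
    0ℚ * a ^ k        ≡⟨ *-zeroˡ (a ^ k) ⟩
    0ℚ                ≤⟨ *-nonNeg 0≤N (^-nonNeg k 0≤d) ⟩
    N * d ^ k         ∎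
    where open ≤-Reasoning
  ... | no  d≢0 = tangent-at-slope k {N = N} μ 0≤d μd≡a (tangent μ (*-nonNeg 0≤a (inv-nonNeg 0≤d)))
    where
    μ = a * inv d
    μd≡a : μ * d ≡ a
    μd≡a = trans (*-assoc a (inv d) d) (trans (cong (a *_) (trans (*-comm (inv d) d) (*-inv d≢0))) (*-identityʳ a))

module Walks {n : ℕ} (B : Fin n → Fin n → Bool) (B-sym : ∀ y z → B y z ≡ B z y) where
  open import Data.Rational using (_+_; _*_; _≤_)
  open Arithmetic
  open Sums
  open AM-GM using (am-gm-linearised)
  open +-*-Solver

  deg : Fin n → ℚ
  deg y = ∑[ z < n ] 𝟙 (B y z)

  deg-nonNeg : ∀ y → 0ℚ ≤ deg y
  deg-nonNeg y = ∑-nonNeg (allFin n) (λ z → 𝟙-nonNeg (B y z))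

  𝟙≤deg : ∀ y z → 𝟙 (B y z) ≤ deg y
  𝟙≤deg y z = ≤-∑ (allFin n) (λ z′ → 𝟙-nonNeg (B y z′)) (∈-allFin z)

  nonIsolated : Fin n → ℚ
  nonIsolated y = deg y * inv (deg y)

  nonIsolated-𝟙 : ∀ y z → nonIsolated y * 𝟙 (B y z) ≡ 𝟙 (B y z)
  nonIsolated-𝟙 y z with B y z in yz
  ... | true  = trans (*-identityʳ (nonIsolated y)) (*-inv (𝟙≤⇒≢0 yz (𝟙≤deg y z)))
  ... | false = *-zeroʳ (nonIsolated y)

  transfer : (Fin n → ℚ) → Fin n → ℚ
  transfer h y = ∑[ x < n ] 𝟙 (B y x) * h x

  ∑-transfer : ∀ h → ∑[ y < n ] transfer h y ≡ ∑[ x < n ] deg x * h x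
  ∑-transfer h = trans (∑-comm (allFin n) (allFin n) (λ y x → 𝟙 (B y x) * h x)) (∑-cong (allFin n) λ x →
    trans (∑-cong (allFin n) (λ y → cong (λ b → 𝟙 b * h x) (B-sym y x)))
          (sym (*-distribʳ-∑ (h x) (allFin n) (λ y → 𝟙 (B x y)))))

  transfer-nonIsolated : ∀ h y → nonIsolated y * transfer h y ≡ transfer h y
  transfer-nonIsolated h y = trans (*-distribˡ-∑ (nonIsolated y) (allFin n) (λ x → 𝟙 (B y x) * h x))
    (∑-cong (allFin n) λ x → trans (sym (*-assoc (nonIsolated y) (𝟙 (B y x)) (h x)))
                                   (cong (_* h x) (nonIsolated-𝟙 y x)))

  transfer-one : ∀ y → transfer (λ _ → 1ℚ) y ≡ deg y
  transfer-one y = ∑-cong (allFin n) (λ x → *-identityʳ (𝟙 (B y x)))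

  isWalk : ∀ k → (Fin (suc k) → Fin n) → Bool
  isWalk zero    w = true
  isWalk (suc k) w = B (w zero) (w (suc zero)) ∧ isWalk k (Vec.tail w)

  walks : ℕ → ℚ
  walks k = ∑[ w ∈ allMaps (suc k) n ] 𝟙 (isWalk k w)

  isWalk⇒edge : ∀ k w → isWalk k w ≡ true → ∀ j → B (w (inject₁ j)) (w (suc j)) ≡ true
  isWalk⇒edge (suc k) w walk zero    = ∧-conicalˡ _ _ walk
  isWalk⇒edge (suc k) w walk (suc j) = isWalk⇒edge k (Vec.tail w) (∧-conicalʳ _ _ walk) j

  nonIsolated-isWalk : ∀ k w → nonIsolated (w zero) * 𝟙 (isWalk (suc k) w) ≡ 𝟙 (isWalk (suc k) w)
  nonIsolated-isWalk k w = begin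
    nonIsolated w₀ * 𝟙 (B w₀ w₁ ∧ rest)         ≡⟨ cong (nonIsolated w₀ *_) (𝟙-∧ (B w₀ w₁) rest) ⟩
    nonIsolated w₀ * (𝟙 (B w₀ w₁) * 𝟙 rest)     ≡⟨ *-assoc (nonIsolated w₀) (𝟙 (B w₀ w₁)) (𝟙 rest) ⟨
    nonIsolated w₀ * 𝟙 (B w₀ w₁) * 𝟙 rest       ≡⟨ cong (_* 𝟙 rest) (nonIsolated-𝟙 w₀ w₁) ⟩
    𝟙 (B w₀ w₁) * 𝟙 rest                        ≡⟨ 𝟙-∧ (B w₀ w₁) rest ⟨
    𝟙 (B w₀ w₁ ∧ rest)                          ∎
    where
    open ≡-Reasoning
    w₀ = w zero
    w₁ = w (suc zero)
    rest = isWalk k (Vec.tail w)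

  ∑-isWalk-suc : ∀ k (h : Fin n → ℚ) (G : (Fin (suc k) → Fin n) → ℚ) →
    ∑[ w ∈ allMaps (suc (suc k)) n ] 𝟙 (isWalk (suc k) w) * (h (w zero) * G (Vec.tail w)) ≡
    ∑[ w ∈ allMaps (suc k) n ] 𝟙 (isWalk k w) * (transfer h (w zero) * G w)
  ∑-isWalk-suc k h G = trans (∑-allMaps-suc (suc k) n _) (∑-cong (allMaps (suc k) n) λ w → begin
    ∑[ x < n ] 𝟙 (B x (w zero) ∧ isWalk k w) * (h x * G w)
      ≡⟨ ∑-cong (allFin n) (λ x → per-vertex x w) ⟩
    ∑[ x < n ] 𝟙 (isWalk k w) * G w * (𝟙 (B (w zero) x) * h x)
      ≡⟨ *-distribˡ-∑ (𝟙 (isWalk k w) * G w) (allFin n) (λ x → 𝟙 (B (w zero) x) * h x) ⟨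
    𝟙 (isWalk k w) * G w * transfer h (w zero)
      ≡⟨ solve 3 (λ a g t → a :* g :* t := a :* (t :* g)) refl (𝟙 (isWalk k w)) (G w) (transfer h (w zero)) ⟩
    𝟙 (isWalk k w) * (transfer h (w zero) * G w) ∎)
    where
    open ≡-Reasoning
    per-vertex : ∀ x w → 𝟙 (B x (w zero) ∧ isWalk k w) * (h x * G w) ≡ 𝟙 (isWalk k w) * G w * (𝟙 (B (w zero) x) * h x)
    per-vertex x w = trans (cong (λ b → 𝟙 (b ∧ isWalk k w) * (h x * G w)) (B-sym x (w zero)))
      (trans (cong (_* (h x * G w)) (𝟙-∧ (B (w zero) x) (isWalk k w)))
             (solve 4 (λ b a hx g → b :* a :* (hx :* g) := a :* g :* (b :* hx)) refl (𝟙 (B (w zero) x)) (𝟙 (isWalk k w)) (h x) (G w)))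

  invDegs : ∀ k → (Fin (suc k) → Fin n) → List ℚ
  invDegs zero          w = []
  invDegs (suc zero)    w = []
  invDegs (suc (suc k)) w = inv (deg (w (suc zero))) ∷ invDegs (suc k) (Vec.tail w)

  length-invDegs : ∀ k w → length (invDegs (suc k) w) ≡ k
  length-invDegs zero    w = refl
  length-invDegs (suc k) w = cong suc (length-invDegs k (Vec.tail w))

  invDegs-nonNeg : ∀ k w → All (0ℚ ≤_) (invDegs k w)
  invDegs-nonNeg zero          w = []
  invDegs-nonNeg (suc zero)    w = []
  invDegs-nonNeg (suc (suc k)) w = inv-nonNeg (deg-nonNeg (w (suc zero))) ∷ invDegs-nonNeg (suc k) (Vec.tail w)

  weight : ∀ k → (Fin (suc k) → Fin n) → ℚ
  weight k w = product (invDegs k w)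

  -- The degree measure is stationary for the random walk, whose transition y → x has probability 𝟙 (B y x) / deg y.
  ∑-isWalk-weight : ∀ k h →
    ∑[ w ∈ allMaps (suc (suc k)) n ] 𝟙 (isWalk (suc k) w) * (h (w zero) * weight (suc k) w) ≡ ∑[ y < n ] deg y * h y
  ∑-isWalk-weight zero h = begin
    ∑[ w ∈ allMaps 2 n ] 𝟙 (isWalk 1 w) * (h (w zero) * weight 1 w)
                                                       ≡⟨ ∑-isWalk-suc 0 h (λ _ → 1ℚ) ⟩
    ∑[ w ∈ allMaps 1 n ] 1ℚ * (transfer h (w zero) * 1ℚ) ≡⟨ ∑-allMaps-suc 0 n (λ w → 1ℚ * (transfer h (w zero) * 1ℚ)) ⟩
    ∑[ g ∈ allMaps 0 n ] ∑[ y < n ] 1ℚ * (transfer h y * 1ℚ)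
                                                       ≡⟨ ∑-allMaps-zero n (λ _ → ∑[ y < n ] 1ℚ * (transfer h y * 1ℚ)) ⟩
    ∑[ y < n ] 1ℚ * (transfer h y * 1ℚ)
      ≡⟨ ∑-cong (allFin n) (λ y → solve 1 (λ t → con 1ℚ :* (t :* con 1ℚ) := t) refl (transfer h y)) ⟩
    ∑[ y < n ] transfer h y                            ≡⟨ ∑-transfer h ⟩
    ∑[ y < n ] deg y * h y                             ∎
    where open ≡-Reasoning
  ∑-isWalk-weight (suc k) h = begin
    ∑[ w ∈ allMaps (suc (suc (suc k))) n ] 𝟙 (isWalk (suc (suc k)) w) * (h (w zero) * weight (suc (suc k)) w)
      ≡⟨ ∑-isWalk-suc (suc k) h (λ w → inv (deg (w zero)) * weight (suc k) w) ⟩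
    ∑[ w ∈ allMaps (suc (suc k)) n ] 𝟙 (isWalk (suc k) w) * (transfer h (w zero) * (inv (deg (w zero)) * weight (suc k) w))
      ≡⟨ ∑-cong (allMaps (suc (suc k)) n) (λ w → cong (𝟙 (isWalk (suc k) w) *_)
           (sym (*-assoc (transfer h (w zero)) (inv (deg (w zero))) (weight (suc k) w)))) ⟩
    ∑[ w ∈ allMaps (suc (suc k)) n ] 𝟙 (isWalk (suc k) w) * (h′ (w zero) * weight (suc k) w)
      ≡⟨ ∑-isWalk-weight k h′ ⟩
    ∑[ y < n ] deg y * (transfer h y * inv (deg y))
      ≡⟨ ∑-cong (allFin n) (λ y → trans (solve 3 (λ d t i → d :* (t :* i) := d :* i :* t) refl (deg y) (transfer h y) (inv (deg y)))
                                       (transfer-nonIsolated h y)) ⟩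
    ∑[ y < n ] transfer h y
      ≡⟨ ∑-transfer h ⟩
    ∑[ y < n ] deg y * h y ∎
    where
    open ≡-Reasoning
    h′ : Fin n → ℚ
    h′ y = transfer h y * inv (deg y)

  degreeSum : ℚ
  degreeSum = ∑[ y < n ] deg y

  nonIsolatedCount : ℚ
  nonIsolatedCount = ∑[ y < n ] nonIsolated y

  peel-weight-sum : ∀ k w →
    let a = 𝟙 (isWalk (suc k) w); i = inv (deg (w zero)); W = weight (suc k) w; S = sum (invDegs (suc k) w) in
    a * (deg (w zero) * (i * W * (i + S))) ≡ a * (i * W) + a * (W * S)
  peel-weight-sum k w = begin
    a * (d * (i * W * (i + S)))                ≡⟨ solve 5 (λ a d i W S → a :* (d :* (i :* W :* (i :+ S)))
                                                           := d :* i :* i :* (a :* W) :+ d :* i :* a :* (W :* S))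
                                                          refl a d i W S ⟩
    d * i * i * (a * W) + d * i * a * (W * S)  ≡⟨ cong₂ (λ x y → x * (a * W) + y * (W * S)) (*-inv-*-inv d) (nonIsolated-isWalk k w) ⟩
    i * (a * W) + a * (W * S)                  ≡⟨ cong (_+ a * (W * S)) (solve 3 (λ i a W → i :* (a :* W) := a :* (i :* W)) refl i a W) ⟩
    a * (i * W) + a * (W * S)                  ∎
    where
    open ≡-Reasoning
    a = 𝟙 (isWalk (suc k) w)
    d = deg (w zero)
    i = inv d
    W = weight (suc k) w
    S = sum (invDegs (suc k) w)

  ∑-isWalk-weight-sum : ∀ k →
    ∑[ w ∈ allMaps (suc (suc k)) n ] 𝟙 (isWalk (suc k) w) * (weight (suc k) w * sum (invDegs (suc k) w)) ≡
    fromℕ k * nonIsolatedCount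
  ∑-isWalk-weight-sum zero = begin
    ∑[ w ∈ allMaps 2 n ] 𝟙 (isWalk 1 w) * (1ℚ * 0ℚ)  ≡⟨ ∑-cong (allMaps 2 n) (λ w → trans (cong (𝟙 (isWalk 1 w) *_) (*-zeroʳ 1ℚ))
                                                                                        (*-zeroʳ (𝟙 (isWalk 1 w)))) ⟩
    ∑[ w ∈ allMaps 2 n ] 0ℚ                          ≡⟨ ∑-zero (allMaps 2 n) ⟩
    0ℚ                                               ≡⟨ *-zeroˡ nonIsolatedCount ⟨
    0ℚ * nonIsolatedCount                            ∎
    where open ≡-Reasoning
  ∑-isWalk-weight-sum (suc k) = begin
    ∑[ w ∈ allMaps (suc (suc (suc k))) n ] 𝟙 (isWalk (suc (suc k)) w) * (weight (suc (suc k)) w * sum (invDegs (suc (suc k)) w))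
      ≡⟨ ∑-cong (allMaps (suc (suc (suc k))) n) (λ w → cong (𝟙 (isWalk (suc (suc k)) w) *_) (sym (*-identityˡ (G (Vec.tail w))))) ⟩
    ∑[ w ∈ allMaps (suc (suc (suc k))) n ] 𝟙 (isWalk (suc (suc k)) w) * (1ℚ * G (Vec.tail w))
      ≡⟨ ∑-isWalk-suc (suc k) (λ _ → 1ℚ) G ⟩
    ∑[ w ∈ walks₊ ] a w * (transfer (λ _ → 1ℚ) (w zero) * G w)
      ≡⟨ ∑-cong walks₊ (λ w → trans (cong (λ t → a w * (t * G w)) (transfer-one (w zero))) (peel-weight-sum k w)) ⟩
    ∑[ w ∈ walks₊ ] (a w * (i w * W w) + a w * (W w * S w))
      ≡⟨ ∑-distrib-+ walks₊ (λ w → a w * (i w * W w)) (λ w → a w * (W w * S w)) ⟩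
    (∑[ w ∈ walks₊ ] a w * (i w * W w)) + (∑[ w ∈ walks₊ ] a w * (W w * S w))
      ≡⟨ cong₂ _+_ (∑-isWalk-weight k (λ y → inv (deg y))) (∑-isWalk-weight-sum k) ⟩
    nonIsolatedCount + fromℕ k * nonIsolatedCount
      ≡⟨ solve 2 (λ N K → N :+ K :* N := (con 1ℚ :+ K) :* N) refl nonIsolatedCount (fromℕ k) ⟩
    (1ℚ + fromℕ k) * nonIsolatedCount
      ≡⟨ cong (_* nonIsolatedCount) (fromℕ-suc k) ⟨
    fromℕ (suc k) * nonIsolatedCount ∎
    where
    open ≡-Reasoning
    walks₊ = allMaps (suc (suc k)) n
    a i W S G : (Fin (suc (suc k)) → Fin n) → ℚ
    a w = 𝟙 (isWalk (suc k) w)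
    i w = inv (deg (w zero))
    W w = weight (suc k) w
    S w = sum (invDegs (suc k) w)
    G w = i w * W w * (i w + S w)

  ∑-isWalk-weight≡degreeSum : ∀ k → ∑[ w ∈ allMaps (suc (suc k)) n ] 𝟙 (isWalk (suc k) w) * weight (suc k) w ≡ degreeSum
  ∑-isWalk-weight≡degreeSum k =
    trans (∑-cong (allMaps (suc (suc k)) n) (λ w → cong (𝟙 (isWalk (suc k) w) *_) (sym (*-identityˡ (weight (suc k) w)))))
          (trans (∑-isWalk-weight k (λ _ → 1ℚ)) (∑-cong (allFin n) (λ y → *-identityʳ (deg y))))

  walks-one : walks 1 ≡ degreeSum
  walks-one = trans (∑-cong (allMaps 2 n) (λ w → sym (*-identityʳ (𝟙 (isWalk 1 w))))) (∑-isWalk-weight≡degreeSum 0)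

  walks-tangent : ∀ k μ → 0ℚ ≤ μ →
    fromℕ (suc k) * μ ^ k * degreeSum ≤ walks (suc k) + μ ^ suc k * (fromℕ k * nonIsolatedCount)
  walks-tangent k μ 0≤μ = begin
    c * degreeSum                                    ≡⟨ cong (c *_) (∑-isWalk-weight≡degreeSum k) ⟨
    c * (∑[ w ∈ walks₊ ] a w * W w)                  ≡⟨ *-distribˡ-∑ c walks₊ (λ w → a w * W w) ⟩
    ∑[ w ∈ walks₊ ] c * (a w * W w)
      ≡⟨ ∑-cong walks₊ (λ w → solve 3 (λ c a W → c :* (a :* W) := a :* (c :* W)) refl c (a w) (W w)) ⟩
    ∑[ w ∈ walks₊ ] a w * (c * W w)
      ≤⟨ ∑-mono-≤ walks₊ (λ w → *-monoˡ-≤-nonNeg′ (𝟙-nonNeg (isWalk (suc k) w)) (weight-am-gm w)) ⟩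
    ∑[ w ∈ walks₊ ] a w * (1ℚ + d * W w * S w)       ≡⟨ ∑-cong walks₊ (λ w → distribute (a w) d (W w) (S w)) ⟩
    ∑[ w ∈ walks₊ ] (a w + d * (a w * (W w * S w)))  ≡⟨ ∑-distrib-+ walks₊ a (λ w → d * (a w * (W w * S w))) ⟩
    walks (suc k) + (∑[ w ∈ walks₊ ] d * (a w * (W w * S w)))
                                                     ≡⟨ cong (walks (suc k) +_) (*-distribˡ-∑ d walks₊ (λ w → a w * (W w * S w))) ⟨
    walks (suc k) + d * (∑[ w ∈ walks₊ ] a w * (W w * S w))
                                                     ≡⟨ cong (λ x → walks (suc k) + d * x) (∑-isWalk-weight-sum k) ⟩
    walks (suc k) + d * (fromℕ k * nonIsolatedCount) ∎
    where
    open ≤-Reasoning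
    walks₊ = allMaps (suc (suc k)) n
    c = fromℕ (suc k) * μ ^ k
    d = μ ^ suc k
    a W S : (Fin (suc (suc k)) → Fin n) → ℚ
    a w = 𝟙 (isWalk (suc k) w)
    W w = weight (suc k) w
    S w = sum (invDegs (suc k) w)
    distribute : ∀ a d W S → a * (1ℚ + d * W * S) ≡ a + d * (a * (W * S))
    distribute = solve 4 (λ a d W S → a :* (con 1ℚ :+ d :* W :* S) := a :+ d :* (a :* (W :* S))) refl
    weight-am-gm : ∀ w → c * W w ≤ 1ℚ + d * W w * S w
    weight-am-gm w = subst (λ l → fromℕ (suc l) * μ ^ l * W w ≤ 1ℚ + μ ^ suc l * W w * S w)
                           (length-invDegs k w) (am-gm-linearised (invDegs (suc k) w) μ (invDegs-nonNeg (suc k) w) 0≤μ)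

module Homomorphisms where

  private
    and⁺ : ∀ {xs} → All (_≡ true) xs → and xs ≡ true
    and⁺ []          = refl
    and⁺ (refl ∷ ps) = and⁺ ps

    and⁻ : ∀ xs → and xs ≡ true → All (_≡ true) xs
    and⁻ []       _   = []
    and⁻ (x ∷ xs) all = ∧-conicalˡ x (and xs) all ∷ and⁻ xs (∧-conicalʳ x (and xs) all)

  isHom-intro : ∀ k adjH (G : Graph) f → (∀ a b → adjH a b ≡ true → adj G (f a) (f b) ≡ true) →
                isHom k adjH G f ≡ true
  isHom-intro k adjH G f preserves =
    and⁺ (All.concat⁺ (All.map⁺ (All.tabulate⁺ λ a → All.map⁺ (All.tabulate⁺ λ b → implies (preserves a b)))))
    where
    implies : ∀ {p q} → (p ≡ true → q ≡ true) → not p ∨ q ≡ true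
    implies {false} _   = refl
    implies {true}  p⇒q = p⇒q refl

  isHom-elim : ∀ k adjH (G : Graph) f → isHom k adjH G f ≡ true →
               ∀ a b → adjH a b ≡ true → adj G (f a) (f b) ≡ true
  isHom-elim k adjH G f hom a b ab = modus-ponens ab
    (All.lookup (All.map⁻ (All.lookup (All.map⁻ (All.concat⁻ (and⁻ _ hom))) (∈-allFin a))) (∈-allFin b))
    where
    modus-ponens : ∀ {p q} → p ≡ true → not p ∨ q ≡ true → q ≡ true
    modus-ponens refl q = q

  last-or-inject₁ : ∀ {M} (a : Fin (suc M)) → a ≡ Fin.fromℕ M ⊎ Σ (Fin M) (λ j → a ≡ inject₁ j)
  last-or-inject₁ {zero}  zero    = inj₁ refl
  last-or-inject₁ {suc M} zero    = inj₂ (zero , refl)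
  last-or-inject₁ {suc M} (suc a) with last-or-inject₁ a
  ... | inj₁ refl       = inj₁ refl
  ... | inj₂ (j , refl) = inj₂ (suc j , refl)

  closedWalk⇒isHom : ∀ (G : Graph) M (g : Fin (suc M) → Fin (v G)) →
    (∀ j → adj G (g (inject₁ j)) (g (suc j)) ≡ true) → adj G (g (Fin.fromℕ M)) (g zero) ≡ true →
    isHom (suc M) (cycleAdj (suc M)) G g ≡ true
  closedWalk⇒isHom G M g step close = isHom-intro (suc M) (cycleAdj (suc M)) G g cycle-edge
    where
    successor-edge : ∀ a b → toℕ b ≡ (toℕ a ℕ.+ 1) ℕ.% suc M → adj G (g a) (g b) ≡ true
    successor-edge a b b≡a+1 with last-or-inject₁ a
    ... | inj₁ refl = subst (λ c → adj G (g (Fin.fromℕ M)) (g c) ≡ true) (sym (Fin.toℕ-injective b≡0)) close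
      where
      b≡0 : toℕ b ≡ 0
      b≡0 = trans b≡a+1 (trans (cong (λ m → (m ℕ.+ 1) ℕ.% suc M) (Fin.toℕ-fromℕ M))
                               (trans (cong (ℕ._% suc M) (ℕ.+-comm M 1)) (n%n≡0 (suc M))))
    ... | inj₂ (j , refl) = subst (λ c → adj G (g (inject₁ j)) (g c) ≡ true) (sym (Fin.toℕ-injective b≡1+j)) (step j)
      where
      b≡1+j : toℕ b ≡ suc (toℕ j)
      b≡1+j = trans b≡a+1 (trans (cong (λ m → (m ℕ.+ 1) ℕ.% suc M) (Fin.toℕ-inject₁ j))
                                 (trans (cong (ℕ._% suc M) (ℕ.+-comm (toℕ j) 1)) (m<n⇒m%n≡m (ℕ.s≤s (Fin.toℕ<n j)))))
    cycle-edge : ∀ a b → cycleAdj (suc M) a b ≡ true → adj G (g a) (g b) ≡ true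
    cycle-edge a b ab with toℕ b ℕ.≡ᵇ (toℕ a ℕ.+ 1) ℕ.% suc M in b≡ᵇa+1
    ... | true  = successor-edge a b (ℕ.≡ᵇ⇒≡ _ _ (subst T (sym b≡ᵇa+1) tt))
    ... | false = trans (Graph.sym G (g a) (g b)) (successor-edge b a (ℕ.≡ᵇ⇒≡ _ _ (subst T (sym ab) tt)))

module CycleCounts (T : Graph) where
  open import Data.Rational using (_+_; _*_; _≤_)
  open Arithmetic
  open Sums
  open AM-GM using (tangent-line-bound)
  open Homomorphisms

  private
    N = v T
    A = adj T

  link : Fin N → Fin N → Fin N → Bool
  link x y z = A x y ∧ (A x z ∧ A y z)

  link-sym : ∀ x y z → link x y z ≡ link x z y
  link-sym x y z with A x y | A x z
  ... | true  | true  = Graph.sym T y z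
  ... | true  | false = refl
  ... | false | true  = refl
  ... | false | false = refl

  link-intro : ∀ {x y z} → A x y ≡ true → A x z ≡ true → A y z ≡ true → link x y z ≡ true
  link-intro {x} {y} {z} xy xz yz rewrite xy | xz | yz = refl

  link-elim : ∀ {x y z} → link x y z ≡ true → A x y ≡ true × A x z ≡ true × A y z ≡ true
  link-elim {x} {y} {z} xyz = ∧-conicalˡ (A x y) _ xyz , ∧-conicalˡ (A x z) (A y z) yz∧xz , ∧-conicalʳ (A x z) (A y z) yz∧xz
    where
    yz∧xz : A x z ∧ A y z ≡ true
    yz∧xz = ∧-conicalʳ (A x y) _ xyz

  module Link (x : Fin N) = Walks (link x) (link-sym x)

  edgeSum : ℚ
  edgeSum = ∑[ x < N ] ∑[ y < N ] 𝟙 (A x y)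

  triangleSum : ℚ
  triangleSum = ∑[ x < N ] Link.degreeSum x

  linkWalks : ℕ → ℚ
  linkWalks k = ∑[ x < N ] Link.walks x (suc k)

  edgeSum-nonNeg : 0ℚ ≤ edgeSum
  edgeSum-nonNeg = ∑-nonNeg (allFin N) (λ x → ∑-nonNeg (allFin N) (λ y → 𝟙-nonNeg (A x y)))

  triangleSum-nonNeg : 0ℚ ≤ triangleSum
  triangleSum-nonNeg = ∑-nonNeg (allFin N) (λ x → ∑-nonNeg (allFin N) (Link.deg-nonNeg x))

  linkWalks-nonNeg : ∀ k → 0ℚ ≤ linkWalks k
  linkWalks-nonNeg k = ∑-nonNeg (allFin N) (λ x → ∑-nonNeg (allMaps (suc (suc k)) N) (λ w → 𝟙-nonNeg (Link.isWalk x (suc k) w)))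

  deg-link-nonEdge : ∀ x y → A x y ≡ false → Link.deg x y ≡ 0ℚ
  deg-link-nonEdge x y xy = trans (∑-cong (allFin N) (λ z → cong (λ b → 𝟙 (b ∧ (A x z ∧ A y z))) xy)) (∑-zero (allFin N))

  nonEdge-if-edgeSum≡0 : edgeSum ≡ 0ℚ → ∀ x y → A x y ≡ false
  nonEdge-if-edgeSum≡0 e≡0 x y with A x y in xy
  ... | false = refl
  ... | true  = ⊥-elim (𝟙≤⇒≢0 xy 𝟙≤edgeSum e≡0)
    where
    𝟙≤edgeSum : 𝟙 (A x y) ≤ edgeSum
    𝟙≤edgeSum = ≤-trans (≤-∑ (allFin N) (λ y′ → 𝟙-nonNeg (A x y′)) (∈-allFin y))
                        (≤-∑ (allFin N) (λ x′ → ∑-nonNeg (allFin N) (λ y′ → 𝟙-nonNeg (A x′ y′))) (∈-allFin x))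

  triangleSum≡0 : edgeSum ≡ 0ℚ → triangleSum ≡ 0ℚ
  triangleSum≡0 e≡0 = trans (∑-cong (allFin N) λ x →
    trans (∑-cong (allFin N) (λ y → deg-link-nonEdge x y (nonEdge-if-edgeSum≡0 e≡0 x y))) (∑-zero (allFin N)))
    (∑-zero (allFin N))

  nonIsolated-link≤𝟙 : ∀ x y → Link.nonIsolated x y ≤ 𝟙 (A x y)
  nonIsolated-link≤𝟙 x y = bound (A x y) refl
    where
    bound : ∀ b → A x y ≡ b → Link.nonIsolated x y ≤ 𝟙 b
    bound true  _  = *-inv≤1 (Link.deg x y)
    bound false xy = ≤-reflexive (trans (cong (λ d → d * inv d) (deg-link-nonEdge x y xy)) (*-zeroˡ (inv 0ℚ)))

  triangleSum-tangent : ∀ k μ → 0ℚ ≤ μ →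
    fromℕ (suc k) * μ ^ k * triangleSum ≤ linkWalks k + μ ^ suc k * (fromℕ k * edgeSum)
  triangleSum-tangent k μ 0≤μ = begin
    c * triangleSum
      ≡⟨ *-distribˡ-∑ c (allFin N) Link.degreeSum ⟩
    ∑[ x < N ] c * Link.degreeSum x
      ≤⟨ ∑-mono-≤ (allFin N) (λ x → Link.walks-tangent x k μ 0≤μ) ⟩
    ∑[ x < N ] (Link.walks x (suc k) + d * (K * Link.nonIsolatedCount x))
      ≡⟨ ∑-distrib-+ (allFin N) (λ x → Link.walks x (suc k)) (λ x → d * (K * Link.nonIsolatedCount x)) ⟩
    linkWalks k + (∑[ x < N ] d * (K * Link.nonIsolatedCount x))
      ≡⟨ cong (linkWalks k +_) pull-constants ⟨
    linkWalks k + d * (K * (∑[ x < N ] Link.nonIsolatedCount x))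
      ≤⟨ +-monoʳ-≤ (linkWalks k) (*-monoˡ-≤-nonNeg′ (^-nonNeg (suc k) 0≤μ)
                                    (*-monoˡ-≤-nonNeg′ (fromℕ-nonNeg k) nonIsolatedCounts≤edgeSum)) ⟩
    linkWalks k + d * (K * edgeSum) ∎
    where
    open ≤-Reasoning
    c = fromℕ (suc k) * μ ^ k
    d = μ ^ suc k
    K = fromℕ k
    pull-constants : d * (K * (∑[ x < N ] Link.nonIsolatedCount x)) ≡ ∑[ x < N ] d * (K * Link.nonIsolatedCount x)
    pull-constants = trans (cong (d *_) (*-distribˡ-∑ K (allFin N) Link.nonIsolatedCount))
                           (*-distribˡ-∑ d (allFin N) (λ x → K * Link.nonIsolatedCount x))
    nonIsolatedCounts≤edgeSum : ∑[ x < N ] Link.nonIsolatedCount x ≤ edgeSum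
    nonIsolatedCounts≤edgeSum = ∑-mono-≤ (allFin N) (λ x → ∑-mono-≤ (allFin N) (nonIsolated-link≤𝟙 x))

  homC-by-first-vertex : ∀ m → fromℕ (homC (suc m) T) ≡
    ∑[ x < N ] ∑[ g ∈ allMaps m N ] 𝟙 (isHom (suc m) (cycleAdj (suc m)) T (x Vec.∷ g))
  homC-by-first-vertex m = trans (length-filterᵇ (isHom (suc m) (cycleAdj (suc m)) T) (allMaps (suc m) N))
    (trans (∑-allMaps-suc m N (λ g → 𝟙 (isHom (suc m) (cycleAdj (suc m)) T g)))
           (∑-comm (allMaps m N) (allFin N) (λ g x → 𝟙 (isHom (suc m) (cycleAdj (suc m)) T (x Vec.∷ g)))))

  edgeSum≤homC₂ : edgeSum ≤ fromℕ (homC 2 T)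
  edgeSum≤homC₂ = begin
    edgeSum
      ≤⟨ ∑-mono-≤ (allFin N) (λ x → ∑-mono-≤ (allFin N) (λ y → 𝟙-mono (edge⇒hom x y))) ⟩
    ∑[ x < N ] ∑[ y < N ] G x (y Vec.∷ λ ())
      ≡⟨ ∑-cong (allFin N) (λ x → trans (sym (∑-allMaps-zero N (H x))) (sym (∑-allMaps-suc 0 N (G x)))) ⟩
    ∑[ x < N ] ∑[ g ∈ allMaps 1 N ] G x g
      ≡⟨ homC-by-first-vertex 1 ⟨
    fromℕ (homC 2 T) ∎
    where
    open ≤-Reasoning
    G : Fin N → (Fin 1 → Fin N) → ℚ
    G x g = 𝟙 (isHom 2 (cycleAdj 2) T (x Vec.∷ g))
    H : Fin N → (Fin 0 → Fin N) → ℚ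
    H x g = ∑[ y < N ] G x (y Vec.∷ g)
    edge⇒hom : ∀ x y → A x y ≡ true → isHom 2 (cycleAdj 2) T (x Vec.∷ y Vec.∷ λ ()) ≡ true
    edge⇒hom x y xy = closedWalk⇒isHom T 1 (x Vec.∷ y Vec.∷ λ ()) (λ { zero → xy }) (trans (Graph.sym T y x) xy)

  homC₃≤triangleSum : fromℕ (homC 3 T) ≤ triangleSum
  homC₃≤triangleSum = begin
    fromℕ (homC 3 T)
      ≡⟨ homC-by-first-vertex 2 ⟩
    ∑[ x < N ] ∑[ g ∈ allMaps 2 N ] 𝟙 (isHom 3 (cycleAdj 3) T (x Vec.∷ g))
      ≤⟨ ∑-mono-≤ (allFin N) (λ x → ∑-mono-≤ (allMaps 2 N) (λ g → 𝟙-mono (triangle⇒link-edge x g))) ⟩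
    ∑[ x < N ] Link.walks x 1
      ≡⟨ ∑-cong (allFin N) Link.walks-one ⟩
    triangleSum ∎
    where
    open ≤-Reasoning
    triangle⇒link-edge : ∀ x g → isHom 3 (cycleAdj 3) T (x Vec.∷ g) ≡ true → Link.isWalk x 1 g ≡ true
    triangle⇒link-edge x g hom = cong (_∧ true) (link-intro (edge zero (suc zero) refl)
                                                           (trans (Graph.sym T x (g (suc zero))) (edge (suc (suc zero)) zero refl))
                                                           (edge (suc zero) (suc (suc zero)) refl))
      where
      edge : ∀ a b → cycleAdj 3 a b ≡ true → A ((x Vec.∷ g) a) ((x Vec.∷ g) b) ≡ true
      edge = isHom-elim 3 (cycleAdj 3) T (x Vec.∷ g) hom

  linkWalks≤homC : ∀ k → linkWalks k ≤ fromℕ (homC (3 ℕ.+ k) T)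
  linkWalks≤homC k = begin
    linkWalks k
      ≤⟨ ∑-mono-≤ (allFin N) (λ x → ∑-mono-≤ (allMaps (suc (suc k)) N) (λ g → 𝟙-mono (linkWalk⇒hom x g))) ⟩
    ∑[ x < N ] ∑[ g ∈ allMaps (suc (suc k)) N ] 𝟙 (isHom (3 ℕ.+ k) (cycleAdj (3 ℕ.+ k)) T (x Vec.∷ g))
      ≡⟨ homC-by-first-vertex (suc (suc k)) ⟨
    fromℕ (homC (3 ℕ.+ k) T) ∎
    where
    open ≤-Reasoning
    linkWalk⇒hom : ∀ x g → Link.isWalk x (suc k) g ≡ true → isHom (3 ℕ.+ k) (cycleAdj (3 ℕ.+ k)) T (x Vec.∷ g) ≡ true
    linkWalk⇒hom x g walk = closedWalk⇒isHom T (suc (suc k)) (x Vec.∷ g) step close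
      where
      link-edge : ∀ j → link x (g (inject₁ j)) (g (suc j)) ≡ true
      link-edge = Link.isWalk⇒edge x (suc k) g walk
      step : ∀ j → A ((x Vec.∷ g) (inject₁ j)) ((x Vec.∷ g) (suc j)) ≡ true
      step zero    = proj₁ (link-elim (link-edge zero))
      step (suc j) = proj₂ (proj₂ (link-elim (link-edge j)))
      close : A (g (Fin.fromℕ (suc k))) x ≡ true
      close = trans (Graph.sym T (g (Fin.fromℕ (suc k))) x) (proj₁ (proj₂ (link-elim (link-edge (Fin.fromℕ k)))))

  homC-bound : ∀ k → fromℕ (homC 3 T) ^ suc k ≤ fromℕ (homC 2 T) ^ k * fromℕ (homC (3 ℕ.+ k) T)
  homC-bound k = begin
    fromℕ (homC 3 T) ^ suc k
      ≤⟨ ^-monoˡ-≤ (suc k) (fromℕ-nonNeg (homC 3 T)) homC₃≤triangleSum ⟩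
    triangleSum ^ suc k
      ≤⟨ tangent-line-bound k triangleSum-nonNeg edgeSum-nonNeg (linkWalks-nonNeg k) triangleSum≡0 (triangleSum-tangent k) ⟩
    linkWalks k * edgeSum ^ k
      ≤⟨ *-monoʳ-≤-nonNeg′ (^-nonNeg k edgeSum-nonNeg) (linkWalks≤homC k) ⟩
    fromℕ (homC (3 ℕ.+ k) T) * edgeSum ^ k
      ≤⟨ *-monoˡ-≤-nonNeg′ (fromℕ-nonNeg (homC (3 ℕ.+ k) T)) (^-monoˡ-≤ k edgeSum-nonNeg edgeSum≤homC₂) ⟩
    fromℕ (homC (3 ℕ.+ k) T) * fromℕ (homC 2 T) ^ k
      ≡⟨ *-comm (fromℕ (homC (3 ℕ.+ k) T)) (fromℕ (homC 2 T) ^ k) ⟩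
    fromℕ (homC 2 T) ^ k * fromℕ (homC (3 ℕ.+ k) T) ∎
    where open ≤-Reasoning

module Densities (T : Graph) .{{_ : ℕ.NonZero (v T)}} where
  open import Data.Rational using (_*_; _≤_)
  open Arithmetic
  open CycleCounts T using (homC-bound)

  private
    P = fromℕ (v T)

    3[1+k]≡2k+[3+k] : ∀ k → 3 ℕ.* suc k ≡ 2 ℕ.* k ℕ.+ (3 ℕ.+ k)
    3[1+k]≡2k+[3+k] = solve 1 (λ k → con 3 :* (con 1 :+ k) := con 2 :* k :+ (con 3 :+ k)) refl
      where open ℕ-Solver.+-*-Solver

  P^m*tC≡homC : ∀ m → P ^ m * tC m T ≡ fromℕ (homC m T)
  P^m*tC≡homC m = begin
    P ^ m * tC m T              ≡⟨ cong (_* tC m T) (fromℕ-^ (v T) m) ⟨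
    fromℕ (v T ℕ.^ m) * tC m T  ≡⟨ *-comm (fromℕ (v T ℕ.^ m)) (tC m T) ⟩
    tC m T * fromℕ (v T ℕ.^ m)  ≡⟨ /-*-fromℕ (homC m T) (v T ℕ.^ m) {{ℕ.m^n≢0 (v T) m}} ⟩
    fromℕ (homC m T)            ∎
    where open ≡-Reasoning

  cycle-density-bound : ∀ k → tC 3 T ^ suc k ≤ tC 2 T ^ k * tC (3 ℕ.+ k) T
  cycle-density-bound k = *-cancelˡ-≤-pos′ (^-pos (3 ℕ.* suc k) (fromℕ-pos (v T)))
    (subst₂ _≤_ (sym scaled-lhs) (sym scaled-rhs) (homC-bound k))
    where
    open ≡-Reasoning
    scaled-lhs : P ^ (3 ℕ.* suc k) * tC 3 T ^ suc k ≡ fromℕ (homC 3 T) ^ suc k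
    scaled-lhs = begin
      P ^ (3 ℕ.* suc k) * tC 3 T ^ suc k   ≡⟨ cong (_* tC 3 T ^ suc k) (^-assocʳ P 3 (suc k)) ⟨
      (P ^ 3) ^ suc k * tC 3 T ^ suc k     ≡⟨ ^-distrib-* (P ^ 3) (tC 3 T) (suc k) ⟨
      (P ^ 3 * tC 3 T) ^ suc k             ≡⟨ cong (_^ suc k) (P^m*tC≡homC 3) ⟩
      fromℕ (homC 3 T) ^ suc k             ∎
    scaled-rhs : P ^ (3 ℕ.* suc k) * (tC 2 T ^ k * tC (3 ℕ.+ k) T) ≡ fromℕ (homC 2 T) ^ k * fromℕ (homC (3 ℕ.+ k) T)
    scaled-rhs = begin
      P ^ (3 ℕ.* suc k) * (tC 2 T ^ k * tC (3 ℕ.+ k) T)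
        ≡⟨ cong (λ e → P ^ e * (tC 2 T ^ k * tC (3 ℕ.+ k) T)) (3[1+k]≡2k+[3+k] k) ⟩
      P ^ (2 ℕ.* k ℕ.+ (3 ℕ.+ k)) * (tC 2 T ^ k * tC (3 ℕ.+ k) T)
        ≡⟨ cong (_* (tC 2 T ^ k * tC (3 ℕ.+ k) T))
                (trans (^-homo-* P (2 ℕ.* k) (3 ℕ.+ k)) (cong (_* P ^ (3 ℕ.+ k)) (sym (^-assocʳ P 2 k)))) ⟩
      (P ^ 2) ^ k * P ^ (3 ℕ.+ k) * (tC 2 T ^ k * tC (3 ℕ.+ k) T)
        ≡⟨ solve 4 (λ a b c d → a :* b :* (c :* d) := a :* c :* (b :* d)) refl
                   ((P ^ 2) ^ k) (P ^ (3 ℕ.+ k)) (tC 2 T ^ k) (tC (3 ℕ.+ k) T) ⟩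
      (P ^ 2) ^ k * tC 2 T ^ k * (P ^ (3 ℕ.+ k) * tC (3 ℕ.+ k) T)
        ≡⟨ cong₂ _*_ (trans (sym (^-distrib-* (P ^ 2) (tC 2 T) k)) (cong (_^ k) (P^m*tC≡homC 2))) (P^m*tC≡homC (3 ℕ.+ k)) ⟩
      fromℕ (homC 2 T) ^ k * fromℕ (homC (3 ℕ.+ k) T) ∎
      where open +-*-Solver

open Arithmetic using (^ℚ≗^)
open Densities using (cycle-density-bound)
open import Data.Nat using (ℕ; _≤_; _*_; _+_; _∸_; NonZero)
open import Data.Rational using (_≥_) renaming (_*_ to _*ℚ_)

lemma6p7 : (i : ℕ) → 2 ≤ i → (T : Graph) → .{{_ : NonZero (v T)}} →
    (tC 2 T ^ℚ (2 * i ∸ 2)) *ℚ tC (2 * i + 1) T ≥ tC 3 T ^ℚ (2 * i ∸ 1)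
lemma6p7 i@(suc (suc _)) (ℕ.s≤s (ℕ.s≤s ℕ.z≤n)) T =
  subst₂ _≥_ (cong₂ _*ℚ_ (sym (^ℚ≗^ (tC 2 T) k)) (cong (λ m → tC m T) 3+k≡2i+1))
             (sym (^ℚ≗^ (tC 3 T) (suc k)))
             (cycle-density-bound T k)
  where
  k = 2 * i ∸ 2
  3+k≡2i+1 : 3 + k ≡ 2 * i + 1
  3+k≡2i+1 = cong (λ m → suc (suc m)) (ℕ.+-comm 1 k)
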